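{- (i) For every function $\gamma$ from $\mathcal N$ to $\mathcal N$ mapping $E_2$ into $A_2$ there exists $\alpha$ such that both $\alpha$ and $\gamma|\alpha$ belong to $A_2$. (ii) For every function $\gamma$ from $\mathcal N$ to $\mathcal N$ mapping $E^1_1$ into $A^1_1$ there exists $\alpha$ such that both $\alpha$ and $\gamma|\alpha$ belong to $A^1_1$.
   Context: Framework: Brouwer's intuitionistic analysis (intuitionistic logic; countable choice etc.). $\mathcal N=\mathbb N^{\mathbb N}$; finite sequences coded by numbers, $\overline\alpha n=\langle\alpha(0),\dots,\alpha(n-1)\rangle$, $\alpha^m(k)=\alpha(\langle m\rangle*k)$, $\underline0$ the zero sequence. $E_2=\{\alpha:\exists n\,\alpha^n=\underline0\}$; $A_2=\{\alpha:\forall m\exists n\,\alpha^m(n)\ne0\}$; $E^1_1=\{\alpha:\exists\beta\forall n\,\alpha(\overline\beta n)=0\}$; $A^1_1=\{\alpha:\forall\beta\exists n\,\alpha(\overline\beta n)\ne0\}$. A function from $\mathcal N$ to $\mathcal N$ is a code $\gamma$ such that each $\gamma^n$ satisfies $\forall\alpha\exists m\,\gamma^n(\overline\alpha m)\ne0$; $(\gamma|\alpha)(n)=p$ where the first nonzero value $\gamma^n(\overline\alpha m)$ is $p+1$. -}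

module Defs where

open import Data.Nat using (ℕ; zero; suc; _+_; _∸_; _≟_)
open import Data.Product using (Σ; ∃; _×_; _,_)
open import Data.List using (List; []; _∷_)
open import Relation.Nullary using (¬_; yes; no)
open import Relation.Binary.PropositionalEquality using (_≡_; _≢_)

𝒩 : Set
𝒩 = ℕ → ℕ

-- Cantor pairing: pair x y = T(x + y) + x, T n = n(n+1)/2 (a bijection ℕ×ℕ → ℕ)
tri : ℕ → ℕ
tri zero    = zero
tri (suc n) = suc n + tri n

pair : ℕ → ℕ → ℕ
pair x y = tri (x + y) + x

code : List ℕ → ℕ
code []      = zero
code (x ∷ s) = suc (pair x (code s))

-- ⟨ m ⟩ * k : the code of the sequence m followed by the sequence coded by k
cons : ℕ → ℕ → ℕ
cons m k = suc (pair m k)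

initList : 𝒩 → ℕ → List ℕ
initList α zero    = []
initList α (suc n) = α zero ∷ initList (λ i → α (suc i)) n

bar : 𝒩 → ℕ → ℕ
bar α n = code (initList α n)

sub : 𝒩 → ℕ → 𝒩
sub α m k = α (cons m k)

E₂ : 𝒩 → Set
E₂ α = ∃ λ n → ∀ k → sub α n k ≡ 0

A₂ : 𝒩 → Set
A₂ α = ∀ m → ∃ λ n → sub α m n ≢ 0

E¹₁ : 𝒩 → Set
E¹₁ α = ∃ λ (β : 𝒩) → ∀ n → α (bar β n) ≡ 0

A¹₁ : 𝒩 → Set
A¹₁ α = ∀ (β : 𝒩) → ∃ λ n → α (bar β n) ≢ 0

-- γ codes a function from 𝒩 to 𝒩
IsFun : 𝒩 → Set
IsFun γ = ∀ n (α : 𝒩) → ∃ λ m → sub γ n (bar α m) ≢ 0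

firstNZ : (ℕ → ℕ) → ℕ → ℕ → ℕ
firstNZ g zero       i = zero
firstNZ g (suc fuel) i with g i ≟ 0
... | yes _ = firstNZ g fuel (suc i)
... | no  _ = g i ∸ 1

-- (γ|α)(n) = p where the first nonzero value γ^n(ᾱm) is p+1.
-- The witness m from IsFun bounds the search; the result does not depend on it.
apply : (γ : 𝒩) → IsFun γ → 𝒩 → 𝒩
apply γ f α n with f n α
... | m , _ = firstNZ (λ j → sub γ n (bar α j)) (suc m) zero

module Submission where

-- Both parts use that γ|α(t) depends only on an initial segment of α.
-- (i) α is the limit of stages αₖ whose rows from k on vanish, so αₖ ∈ E₂ and row k of γ|αₖ has
-- a nonzero entry; the next stage puts a 1 into row k of α beyond the part of αₖ read to
-- compute that entry, which therefore survives in γ|α.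
-- (ii) α(x) is 1 exactly when, for some prefix t of the sequence coded by x, the values of α
-- below x already make (γ|α)(t) halt with a nonzero output. So a hit of α on a path β is followed
-- by a hit of γ|α. And α hits every β: if α vanishes at β̄0, …, β̄(m₀ - 1), it agrees below m₀
-- with α with the path of β erased, an element of E¹₁; a nonzero value of γ on that at some
-- β̄n₀, computed from m₀ values, then triggers α at β̄(n₀ + m₀).

open import Defs
open import Data.Nat
open import Data.Nat.Properties
open import Data.Product using (∃; _×_; _,_; proj₁; proj₂)
open import Data.List using (List; []; _∷_; length; take)
open import Data.Sum using (inj₁; inj₂)
open import Function using (_∘′_)
open import Relation.Nullary using (Dec; yes; no; contradiction; ¬?)
open import Relation.Nullary.Decidable using (_×-dec_; decidable-stable)
open import Relation.Binary.PropositionalEquality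

-- `next` walks an anti-diagonal of ℕ × ℕ in the order in which `pair` enumerates it.
next : ℕ × ℕ → ℕ × ℕ
next (a , zero)  = (zero , suc a)
next (a , suc c) = (suc a , c)

unpair : ℕ → ℕ × ℕ
unpair zero    = (zero , zero)
unpair (suc y) = next (unpair y)

pair-suc : ∀ a c → pair (suc a) c ≡ suc (pair a (suc c))
pair-suc a c =
  trans (+-suc (tri (suc a + c)) a) (cong (λ z → suc (tri z + a)) (sym (+-suc a c)))

pair-zero-suc : ∀ c → pair zero (suc c) ≡ suc (pair c zero)
pair-zero-suc c = trans (+-identityʳ _)
  (cong suc (trans (+-comm c (tri c)) (cong (λ z → tri z + c) (sym (+-identityʳ c)))))

unpair-pair-diagonal : ∀ a c → unpair (pair zero (a + c)) ≡ (zero , a + c) →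
                       unpair (pair a c) ≡ (a , c)
unpair-pair-diagonal zero    c start = start
unpair-pair-diagonal (suc a) c start = trans (cong unpair (pair-suc a c))
  (cong next (unpair-pair-diagonal a (suc c)
    (subst (λ z → unpair (pair zero z) ≡ (zero , z)) (sym (+-suc a c)) start)))

unpair-pair-zero : ∀ c → unpair (pair zero c) ≡ (zero , c)
unpair-pair-zero zero    = refl
unpair-pair-zero (suc c) = trans (cong unpair (pair-zero-suc c))
  (cong next (unpair-pair-diagonal c zero
    (subst (λ z → unpair (pair zero z) ≡ (zero , z)) (sym (+-identityʳ c)) (unpair-pair-zero c))))

unpair-pair : ∀ a c → unpair (pair a c) ≡ (a , c)
unpair-pair a c = unpair-pair-diagonal a c (unpair-pair-zero (a + c))

cons-injectiveˡ : ∀ {m m′ k k′} → cons m k ≡ cons m′ k′ → m ≡ m′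
cons-injectiveˡ {m} {m′} {k} {k′} eq = cong proj₁
  (trans (sym (unpair-pair m k)) (trans (cong unpair (suc-injective eq)) (unpair-pair m′ k′)))

n≤tri : ∀ n → n ≤ tri n
n≤tri zero    = z≤n
n≤tri (suc n) = m≤m+n (suc n) (tri n)

m≤pair : ∀ m n → m ≤ pair m n
m≤pair m n = m≤n+m m (tri (m + n))

n≤pair : ∀ m n → n ≤ pair m n
n≤pair m n = ≤-trans (m≤n+m n m) (≤-trans (n≤tri (m + n)) (m≤m+n (tri (m + n)) m))

length≤code : ∀ s → length s ≤ code s
length≤code []      = z≤n
length≤code (x ∷ s) = s≤s (≤-trans (length≤code s) (n≤pair x (code s)))

length-initList : ∀ α n → length (initList α n) ≡ n
length-initList α zero    = refl
length-initList α (suc n) = cong suc (length-initList (λ i → α (suc i)) n)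

n≤bar : ∀ α n → n ≤ bar α n
n≤bar α n = subst (_≤ bar α n) (length-initList α n) (length≤code (initList α n))

-- The first argument is fuel; `length≤code` shows that fuel x suffices to decode x.
decodeWithin : ℕ → ℕ → List ℕ
decodeWithin zero    _       = []
decodeWithin (suc f) zero    = []
decodeWithin (suc f) (suc y) = proj₁ (unpair y) ∷ decodeWithin f (proj₂ (unpair y))

decodeWithin-code : ∀ s f → length s ≤ f → decodeWithin f (code s) ≡ s
decodeWithin-code []      zero    _ = refl
decodeWithin-code []      (suc f) _ = refl
decodeWithin-code (x ∷ s) (suc f) (s≤s len≤f) rewrite unpair-pair x (code s) =
  cong (x ∷_) (decodeWithin-code s f len≤f)

decode : ℕ → List ℕ
decode x = decodeWithin x x

decode-bar : ∀ α n → decode (bar α n) ≡ initList α n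
decode-bar α n = decodeWithin-code (initList α n) (bar α n) (length≤code (initList α n))

length-decode-bar : ∀ α n → length (decode (bar α n)) ≡ n
length-decode-bar α n = trans (cong length (decode-bar α n)) (length-initList α n)

take-initList : ∀ α {j n} → j ≤ n → take j (initList α n) ≡ initList α j
take-initList α {zero}          _         = refl
take-initList α {suc j} {suc n} (s≤s j≤n) = cong (α zero ∷_) (take-initList (λ i → α (suc i)) j≤n)

prefix-bar : ∀ α {j n} → j ≤ n → code (take j (decode (bar α n))) ≡ bar α j
prefix-bar α {j} {n} j≤n = cong code (trans (cong (take j) (decode-bar α n)) (take-initList α j≤n))

Agree : 𝒩 → 𝒩 → ℕ → Set
Agree α β n = ∀ x → x < n → α x ≡ β x

Agree-sym : ∀ {α β n} → Agree α β n → Agree β α n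
Agree-sym agree x x<n = sym (agree x x<n)

Agree-trans : ∀ {α β δ n} → Agree α β n → Agree β δ n → Agree α δ n
Agree-trans agree agree′ x x<n = trans (agree x x<n) (agree′ x x<n)

Agree-≤ : ∀ {α β m n} → m ≤ n → Agree α β n → Agree α β m
Agree-≤ m≤n agree x x<m = agree x (<-≤-trans x<m m≤n)

initList-agree : ∀ {α β} n → Agree α β n → initList α n ≡ initList β n
initList-agree zero    agree = refl
initList-agree (suc n) agree = cong₂ _∷_ (agree zero z<s)
  (initList-agree n (λ x x<n → agree (suc x) (s≤s x<n)))

bar-agree : ∀ {α β} n → Agree α β n → bar α n ≡ bar β n
bar-agree n agree = cong code (initList-agree n agree)

_[_≔_] : 𝒩 → ℕ → ℕ → 𝒩
(α [ p ≔ v ]) x with x ≟ p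
... | yes _ = v
... | no  _ = α x

update-here : ∀ α p v → (α [ p ≔ v ]) p ≡ v
update-here α p v with p ≟ p
... | yes _   = refl
... | no  p≢p = contradiction refl p≢p

update-there : ∀ α {p x} v → x ≢ p → (α [ p ≔ v ]) x ≡ α x
update-there α {p} {x} v x≢p with x ≟ p
... | yes x≡p = contradiction x≡p x≢p
... | no  _   = refl

update-agree : ∀ α p v → Agree (α [ p ≔ v ]) α p
update-agree α p v x x<p = update-there α v (<⇒≢ x<p)

-- Since k < L k, the value at x is final from the x-th approximation on.
module DiagonalLimit (a : ℕ → 𝒩) (L : ℕ → ℕ)
                     (L-step : ∀ k → L k ≤ L (suc k))
                     (a-step : ∀ k → Agree (a (suc k)) (a k) (L k))
                     (k<L : ∀ k → k < L k) where

  limit : 𝒩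
  limit x = a x x

  L-mono : ∀ {k k′} → k ≤′ k′ → L k ≤ L k′
  L-mono ≤′-refl        = ≤-refl
  L-mono (≤′-step k≤k′) = ≤-trans (L-mono k≤k′) (L-step _)

  later-agrees : ∀ {k k′} → k ≤′ k′ → Agree (a k′) (a k) (L k)
  later-agrees ≤′-refl              x x<L = refl
  later-agrees (≤′-step {k′} k≤k′) x x<L =
    trans (a-step k′ x (<-≤-trans x<L (L-mono k≤k′))) (later-agrees k≤k′ x x<L)

  limit-agrees : ∀ k → Agree limit (a k) (L k)
  limit-agrees k x x<L with ≤-total x k
  ... | inj₁ x≤k = sym (later-agrees (≤⇒≤′ x≤k) x (k<L x))
  ... | inj₂ k≤x = later-agrees (≤⇒≤′ k≤x) x x<L

firstNZ-cong : ∀ g h fuel i → (∀ x → x < i + fuel → g x ≡ h x) →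
               firstNZ g fuel i ≡ firstNZ h fuel i
firstNZ-cong g h zero       i g≗h = refl
firstNZ-cong g h (suc fuel) i g≗h
  with g i ≟ 0 | h i ≟ 0 | g≗h i (subst (i <_) (sym (+-suc i fuel)) (s≤s (m≤m+n i fuel)))
... | yes _    | yes _    | _  =
  firstNZ-cong g h fuel (suc i) (λ x x< → g≗h x (subst (x <_) (sym (+-suc i fuel)) x<))
... | yes gi≡0 | no  hi≢0 | eq = contradiction (trans (sym eq) gi≡0) hi≢0
... | no  gi≢0 | yes hi≡0 | eq = contradiction (trans eq hi≡0) gi≢0
... | no  _    | no  _    | eq = cong (_∸ 1) eq

firstNZ-more-fuel : ∀ g a i d → g (i + a) ≢ 0 → firstNZ g (suc a + d) i ≡ firstNZ g (suc a) i
firstNZ-more-fuel g zero i d gi≢0 with g i ≟ 0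
... | yes gi≡0 = contradiction (trans (cong g (+-identityʳ i)) gi≡0) gi≢0
... | no  _   = refl
firstNZ-more-fuel g (suc a) i d ga≢0 with g i ≟ 0
... | yes _ = firstNZ-more-fuel g a (suc i) d (λ ga0 → ga≢0 (trans (cong g (+-suc i a)) ga0))
... | no  _ = refl

firstNZ-fuel-≤ : ∀ g {a b} → a ≤ b → g a ≢ 0 → firstNZ g (suc b) 0 ≡ firstNZ g (suc a) 0
firstNZ-fuel-≤ g {a} a≤b ga≢0 with m≤n⇒∃[o]m+o≡n a≤b
... | d , refl = firstNZ-more-fuel g a 0 d ga≢0

firstNZ-fuel-irrelevant : ∀ g a b → g a ≢ 0 → g b ≢ 0 → firstNZ g (suc a) 0 ≡ firstNZ g (suc b) 0
firstNZ-fuel-irrelevant g a b ga≢0 gb≢0 with ≤-total a b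
... | inj₁ a≤b = sym (firstNZ-fuel-≤ g a≤b ga≢0)
... | inj₂ b≤a = firstNZ-fuel-≤ g b≤a gb≢0

-- The computation of (γ|α)(t) has halted once it has read ᾱm, with result `output`.
module _ (γ : 𝒩) where

  Halted : ℕ → 𝒩 → ℕ → Set
  Halted t α m = sub γ t (bar α m) ≢ 0

  output : ℕ → 𝒩 → ℕ → ℕ
  output t α m = firstNZ (λ i → sub γ t (bar α i)) (suc m) 0

  Halted-agree : ∀ {t α β m} → Agree α β m → Halted t α m → Halted t β m
  Halted-agree {t} {m = m} agree halted = halted ∘′ trans (cong (sub γ t) (bar-agree m agree))

  output-agree : ∀ {t α β m} → Agree α β m → output t α m ≡ output t β m
  output-agree {t} {m = m} agree = firstNZ-cong _ _ (suc m) 0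
    λ i i<1+m → cong (sub γ t) (bar-agree i (Agree-≤ (m<1+n⇒m≤n i<1+m) agree))

  module _ (f : IsFun γ) where

    modulus : ℕ → 𝒩 → ℕ
    modulus t α = proj₁ (f t α)

    halted-at-modulus : ∀ t α → Halted t α (modulus t α)
    halted-at-modulus t α = proj₂ (f t α)

    apply-output : ∀ {t α m} → Halted t α m → apply γ f α t ≡ output t α m
    apply-output {t} {α} {m} halted =
      firstNZ-fuel-irrelevant _ (modulus t α) m (halted-at-modulus t α) halted

    apply-determined : ∀ {t α β m} → Halted t α m → Agree α β m → apply γ f β t ≡ output t α m
    apply-determined {t} halted agree =
      trans (apply-output {t} (Halted-agree {t} agree halted)) (sym (output-agree {t} agree))

    apply-continuous : ∀ {t α β m} → Halted t α m → Agree α β m → apply γ f β t ≡ apply γ f α t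
    apply-continuous {t} halted agree =
      trans (apply-determined {t} halted agree) (sym (apply-output {t} halted))

OnPath : 𝒩 → ℕ → Set
OnPath β y = ∃ λ i → i < suc y × bar β i ≡ y

onPath? : ∀ β y → Dec (OnPath β y)
onPath? β y = anyUpTo? (λ i → bar β i ≟ y) (suc y)

bar-onPath : ∀ β n → OnPath β (bar β n)
bar-onPath β n = n , s≤s (n≤bar β n) , refl

erasePath : 𝒩 → 𝒩 → 𝒩
erasePath β α y with onPath? β y
... | yes _ = 0
... | no  _ = α y

erasePath-E¹₁ : ∀ β α → E¹₁ (erasePath β α)
erasePath-E¹₁ β α = β , erased
  where
  erased : ∀ n → erasePath β α (bar β n) ≡ 0
  erased n with onPath? β (bar β n)
  ... | yes _   = refl
  ... | no  off = contradiction (bar-onPath β n) off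

erasePath-agree : ∀ β α {m} → (∀ i → i < m → α (bar β i) ≡ 0) → Agree α (erasePath β α) m
erasePath-agree β α vanish y y<m with onPath? β y
... | yes (i , i≤y , bar≡y) = trans (cong α (sym bar≡y)) (vanish i (≤-<-trans (m<1+n⇒m≤n i≤y) y<m))
... | no  _                 = refl

indicator : {P : Set} → Dec P → ℕ
indicator (yes _) = 1
indicator (no  _) = 0

indicator-yes : {P : Set} (d : Dec P) → P → indicator d ≡ 1
indicator-yes (yes _) _ = refl
indicator-yes (no ¬p) p = contradiction p ¬p

indicator-≢0 : {P : Set} (d : Dec P) → indicator d ≢ 0 → P
indicator-≢0 (yes p) _   = p
indicator-≢0 (no  _) ≢0 = contradiction refl ≢0

module PartI (γ : 𝒩) (f : IsFun γ) (E₂→A₂ : ∀ α → E₂ α → A₂ (apply γ f α)) where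

  record Stage (k : ℕ) : Set where
    field
      seq      : 𝒩
      bound    : ℕ
      vanishes : ∀ m → k ≤ m → ∀ q → sub seq m q ≡ 0

  module Step {k : ℕ} (stage : Stage k) where
    open Stage stage

    witness : ℕ
    witness = proj₁ (E₂→A₂ seq (k , vanishes k ≤-refl) k)

    witness-≢0 : apply γ f seq (cons k witness) ≢ 0
    witness-≢0 = proj₂ (E₂→A₂ seq (k , vanishes k ≤-refl) k)

    read : ℕ
    read = modulus γ f (cons k witness) seq

    column : ℕ
    column = bound + read

    position : ℕ
    position = cons k column

    column<position : column < position
    column<position = s≤s (n≤pair k column)

    vanishes-after : ∀ m → suc k ≤ m → ∀ q → sub (seq [ position ≔ 1 ]) m q ≡ 0
    vanishes-after m k<m q = trans
      (update-there seq 1 (λ eq → <⇒≢ k<m (sym (cons-injectiveˡ eq))))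
      (vanishes m (<⇒≤ k<m) q)

    next-stage : Stage (suc k)
    next-stage = record
      { seq = seq [ position ≔ 1 ] ; bound = suc position ; vanishes = vanishes-after }

  stages : ∀ k → Stage k
  stages zero    = record { seq = λ _ → 0 ; bound = 1 ; vanishes = λ _ _ _ → refl }
  stages (suc k) = Step.next-stage (stages k)

  a : ℕ → 𝒩
  a k = Stage.seq (stages k)

  L : ℕ → ℕ
  L k = Stage.bound (stages k)

  module S (k : ℕ) = Step (stages k)

  L≤column : ∀ k → L k ≤ S.column k
  L≤column k = m≤m+n (L k) (S.read k)

  column<L : ∀ k → S.column k < L (suc k)
  column<L k = m≤n⇒m≤1+n (S.column<position k)

  L-step : ∀ k → L k ≤ L (suc k)
  L-step k = ≤-trans (L≤column k) (<⇒≤ (column<L k))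

  a-step : ∀ k → Agree (a (suc k)) (a k) (L k)
  a-step k = Agree-≤ (≤-trans (L≤column k) (<⇒≤ (S.column<position k)))
                     (update-agree (a k) (S.position k) 1)

  k<L : ∀ k → k < L k
  k<L zero    = z<s
  k<L (suc k) = s≤s (s≤s (m≤pair k (S.column k)))

  open DiagonalLimit a L L-step a-step k<L

  limit-A₂ : A₂ limit
  limit-A₂ k = S.column k , λ eq → 0≢1+n (begin
    0                         ≡⟨ sym eq ⟩
    limit (S.position k)      ≡⟨ limit-agrees (suc k) (S.position k) ≤-refl ⟩
    a (suc k) (S.position k)  ≡⟨ update-here (a k) (S.position k) 1 ⟩
    1                         ∎)
    where open ≡-Reasoning

  apply-limit-A₂ : A₂ (apply γ f limit)
  apply-limit-A₂ k = S.witness k , λ apply≡0 → S.witness-≢0 k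
    (trans (sym (apply-continuous γ f {t} (halted-at-modulus γ f t (a k)) agree)) apply≡0)
    where
    t : ℕ
    t = cons k (S.witness k)

    read≤position : S.read k ≤ S.position k
    read≤position = ≤-trans (m≤n+m (S.read k) (L k)) (<⇒≤ (S.column<position k))

    agree : Agree (a k) limit (S.read k)
    agree = Agree-≤ read≤position (Agree-sym (Agree-trans
      (Agree-≤ (n≤1+n (S.position k)) (limit-agrees (suc k)))
      (update-agree (a k) (S.position k) 1)))

  result : ∃ λ α → A₂ α × A₂ (apply γ f α)
  result = limit , limit-A₂ , apply-limit-A₂

module PartII (γ : 𝒩) (f : IsFun γ) (E¹₁→A¹₁ : ∀ α → E¹₁ α → A¹₁ (apply γ f α)) where

  HaltedNonzero : 𝒩 → ℕ → ℕ → Set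
  HaltedNonzero α t m = Halted γ t α m × output γ t α m ≢ 0

  haltedNonzero? : ∀ α t m → Dec (HaltedNonzero α t m)
  haltedNonzero? α t m = ¬? (sub γ t (bar α m) ≟ 0) ×-dec ¬? (output γ t α m ≟ 0)

  Trigger : 𝒩 → ℕ → Set
  Trigger α x = ∃ λ j → j < suc (length (decode x)) ×
                ∃ λ m → m < suc x × HaltedNonzero α (code (take j (decode x))) m

  trigger? : ∀ α x → Dec (Trigger α x)
  trigger? α x = anyUpTo? (λ j → anyUpTo? (λ m → haltedNonzero? α (code (take j (decode x))) m) (suc x))
                          (suc (length (decode x)))

  approx : ℕ → 𝒩
  approx zero    = λ _ → 0
  approx (suc x) = approx x [ x ≔ indicator (trigger? (approx x) x) ]

  open DiagonalLimit (λ x → approx (suc x)) suc (λ x → n≤1+n (suc x))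
                     (λ x → update-agree (approx (suc x)) (suc x) _) (λ _ → ≤-refl)
    renaming (limit to α)

  approx-agrees : ∀ x → Agree (approx x) α x
  approx-agrees zero    = λ _ ()
  approx-agrees (suc x) = Agree-sym (limit-agrees x)

  α-indicator : ∀ x → α x ≡ indicator (trigger? (approx x) x)
  α-indicator x = update-here (approx x) x _

  apply-α-hits : ∀ β i → α (bar β i) ≢ 0 → ∃ λ j → apply γ f α (bar β j) ≢ 0
  apply-α-hits β i α≢0
    with indicator-≢0 (trigger? (approx (bar β i)) (bar β i)) (α≢0 ∘′ trans (α-indicator (bar β i)))
  ... | j , j<1+len , m , m<1+x , halted , output≢0 = j , λ apply≡0 → output≢0 (begin
    output γ t (approx x) m ≡⟨ sym (apply-determined γ f {t} halted agree) ⟩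
    apply γ f α t           ≡⟨ cong (apply γ f α) (prefix-bar β j≤i) ⟩
    apply γ f α (bar β j)   ≡⟨ apply≡0 ⟩
    0                       ∎)
    where
    open ≡-Reasoning
    x : ℕ
    x = bar β i
    t : ℕ
    t = code (take j (decode x))
    agree : Agree (approx x) α m
    agree = Agree-≤ (m<1+n⇒m≤n m<1+x) (approx-agrees x)
    j≤i : j ≤ i
    j≤i = subst (j ≤_) (length-decode-bar β i) (m<1+n⇒m≤n j<1+len)

  α-hits : ∀ β → ∃ λ n → α (bar β n) ≢ 0
  α-hits β = hits (anyUpTo? (λ i → ¬? (α (bar β i) ≟ 0)) m₀)
    where
    erased : 𝒩
    erased = erasePath β α

    n₀ : ℕ
    n₀ = proj₁ (E¹₁→A¹₁ erased (erasePath-E¹₁ β α) β)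

    n₀-hit : apply γ f erased (bar β n₀) ≢ 0
    n₀-hit = proj₂ (E¹₁→A¹₁ erased (erasePath-E¹₁ β α) β)

    m₀ : ℕ
    m₀ = modulus γ f (bar β n₀) erased

    x : ℕ
    x = bar β (n₀ + m₀)

    m₀≤x : m₀ ≤ x
    m₀≤x = ≤-trans (m≤n+m m₀ n₀) (n≤bar β (n₀ + m₀))

    hits : Dec (∃ λ i → i < m₀ × α (bar β i) ≢ 0) → ∃ λ n → α (bar β n) ≢ 0
    hits (yes (i , _ , α≢0)) = i , α≢0
    hits (no none) = n₀ + m₀ , λ α≡0 → 0≢1+n (begin
      0                                  ≡⟨ sym α≡0 ⟩
      α x                                ≡⟨ α-indicator x ⟩
      indicator (trigger? (approx x) x)  ≡⟨ indicator-yes _ triggered ⟩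
      1                                  ∎)
      where
      open ≡-Reasoning
      vanish : ∀ i → i < m₀ → α (bar β i) ≡ 0
      vanish i i<m₀ = decidable-stable (α (bar β i) ≟ 0) (λ α≢0 → none (i , i<m₀ , α≢0))

      agree : Agree erased (approx x) m₀
      agree = Agree-trans (Agree-sym (erasePath-agree β α vanish))
                          (Agree-sym (Agree-≤ m₀≤x (approx-agrees x)))

      haltedNonzero : HaltedNonzero (approx x) (bar β n₀) m₀
      haltedNonzero = Halted-agree γ {bar β n₀} agree (halted-at-modulus γ f (bar β n₀) erased)
                    , λ output≡0 → n₀-hit (trans (output-agree γ {bar β n₀} agree) output≡0)

      n₀≤n₀+m₀ : n₀ ≤ n₀ + m₀
      n₀≤n₀+m₀ = m≤m+n n₀ m₀

      triggered : Trigger (approx x) x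
      triggered =
        n₀ , s≤s (subst (n₀ ≤_) (sym (length-decode-bar β (n₀ + m₀))) n₀≤n₀+m₀) ,
        m₀ , s≤s m₀≤x ,
        subst (λ t → HaltedNonzero (approx x) t m₀) (sym (prefix-bar β n₀≤n₀+m₀)) haltedNonzero

  result : ∃ λ α → A¹₁ α × A¹₁ (apply γ f α)
  result = α , α-hits , λ β → let i , α≢0 = α-hits β in apply-α-hits β i α≢0

theorem8p4 : ((γ : 𝒩) (f : IsFun γ) → (∀ α → E₂ α → A₂ (apply γ f α)) →
    ∃ λ α → A₂ α × A₂ (apply γ f α))
    ×
    ((γ : 𝒩) (f : IsFun γ) → (∀ α → E¹₁ α → A¹₁ (apply γ f α)) →
    ∃ λ α → A¹₁ α × A¹₁ (apply γ f α))
theorem8p4 = PartI.result , PartII.result
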